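{- Let $\mathcal{A}=(M,N,A,\pi_c,\pi_d,V_{\min},V_{\max},V_0)$ be a multi-mode system with discrete costs, let $t_{\max}>0$, $\epsilon\ge 0$, and let $\sigma$ be a finite schedule with time horizon $t_{\max}$ that is safe (respectively $\epsilon$-safe). Then there exists an angular schedule $\sigma'$ with time horizon $t_{\max}$ that is safe (respectively $\epsilon$-safe) and satisfies $\pi(\sigma')\le\pi(\sigma)$.
   Context: A multi-mode system with discrete costs is a tuple $\mathcal{A}=(M,N,A,\pi_c,\pi_d,V_{\min},V_{\max},V_0)$ where $M$ is a finite set of modes, $N\ge1$, $A:M\to\mathbb{Q}^N$ gives the constant slope of the variables in each mode, $\pi_c:M\to\mathbb{Q}_{\ge0}$ is the cost per time unit in a mode, $\pi_d:M\to\mathbb{Q}_{\ge0}$ is the cost of switching to a mode, $V_{\min}<V_{\max}$ in $\mathbb{Q}^N$ define the safe set $S=\{x: V_{\min}\le x\le V_{\max}\}$, and $V_0\in S$. A schedule with time horizon $t_{\max}$ is a finite sequence $\sigma=\langle(m_1,t_1),\dots,(m_k,t_k)\rangle$ with $m_i\in M$, $t_i>0$, $\sum t_i=t_{\max}$; its run is $\langle V_0,\dots,V_k\rangle$ with $V_{i+1}=V_i+t_{i+1}A(m_{i+1})$. It is safe if $V_{\min}\le V_i\le V_{\max}$ for $1\le i\le k$, and $\epsilon$-safe if $V_{\min}-\epsilon\mathbf 1<V_i<V_{\max}+\epsilon\mathbf 1$ for $1\le i\le k$. Its total cost is $\pi(\sigma)=\sum_i\pi_d(m_i)+\pi_c(m_i)t_i$.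 A finite schedule is angular if there are no two consecutive timed actions $(m_i,t_i),(m_{i+1},t_{i+1})$ with $A(m_i)=A(m_{i+1})$.
   Formalization: The delays of the timed actions take values in ℚ instead of ℝ≥0, and the time horizon $t_{\max}$ and the tolerance $\epsilon$ are rational as well. -}

module Defs where

open import Data.Nat using (ℕ) renaming (_≤_ to _≤ℕ_)
open import Data.Fin using (Fin)
open import Data.Rational using (ℚ; 0ℚ; _+_; _*_; _-_; _<_; _≤_)
open import Data.List using (List; []; _∷_)
open import Data.List.Relation.Unary.All using (All)
open import Data.List.Relation.Unary.Linked using (Linked)
open import Data.Product using (_×_; _,_; proj₁; proj₂)
open import Relation.Binary.PropositionalEquality using (_≡_)
open import Relation.Nullary using (¬_)

record MMS : Set where
  field
    nModes  : ℕ
    dim     : ℕ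
    dim≥1   : 1 ≤ℕ dim
    A       : Fin nModes → Fin dim → ℚ
    πc      : Fin nModes → ℚ
    πd      : Fin nModes → ℚ
    πc≥0    : ∀ m → 0ℚ ≤ πc m
    πd≥0    : ∀ m → 0ℚ ≤ πd m
    Vmin    : Fin dim → ℚ
    Vmax    : Fin dim → ℚ
    Vmin<Vmax : ∀ j → Vmin j < Vmax j
    V0      : Fin dim → ℚ
    V0∈S    : ∀ j → (Vmin j ≤ V0 j) × (V0 j ≤ Vmax j)

module _ (𝒜 : MMS) where
  open MMS 𝒜

  TimedAction : Set
  TimedAction = Fin nModes × ℚ

  duration : List TimedAction → ℚ
  duration [] = 0ℚ
  duration ((m , t) ∷ σ) = t + duration σ

  IsSchedule : ℚ → List TimedAction → Set
  IsSchedule tmax σ = All (λ a → 0ℚ < proj₂ a) σ × duration σ ≡ tmax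

  -- The run ⟨V_1, …, V_k⟩ (V_0 omitted) from a starting point.
  runFrom : (Fin dim → ℚ) → List TimedAction → List (Fin dim → ℚ)
  runFrom V [] = []
  runFrom V ((m , t) ∷ σ) = V' ∷ runFrom V' σ
    where
    V' : Fin dim → ℚ
    V' j = V j + t * A m j

  run : List TimedAction → List (Fin dim → ℚ)
  run = runFrom V0

  Safe : List TimedAction → Set
  Safe σ = All (λ V → ∀ j → (Vmin j ≤ V j) × (V j ≤ Vmax j)) (run σ)

  EpsSafe : ℚ → List TimedAction → Set
  EpsSafe ε σ = All (λ V → ∀ j → (Vmin j - ε < V j) × (V j < Vmax j + ε)) (run σ)

  cost : List TimedAction → ℚ
  cost [] = 0ℚ
  cost ((m , t) ∷ σ) = (πd m + πc m * t) + cost σ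

  SameSlope : Fin nModes → Fin nModes → Set
  SameSlope m m' = ∀ j → A m j ≡ A m' j

  Angular : List TimedAction → Set
  Angular = Linked (λ a b → ¬ SameSlope (proj₁ a) (proj₁ b))

-- Two consecutive actions with the same slope can be replaced by a single action
-- of the cheaper of the two modes, lasting for the sum of their durations. The run
-- loses exactly the intermediate point and every other point is unchanged, so any
-- coordinatewise constraint on the run (safety, ε-safety) survives; one switching
-- cost disappears and the rate of the merged action is the smaller one, so with
-- nonnegative costs the total cost does not increase. Performing this merge while
-- rebuilding the schedule from the right produces an angular schedule.
module Submission where

open import Defs
open import Data.Rational using (ℚ; 0ℚ; _<_; _≤_; _+_; _*_; _-_; _≤?_; nonNegative)
open import Data.Rational.Properties
  using (_≟_; ≤-refl; <⇒≤; ≰⇒>; +-mono-≤; +-monoʳ-≤; +-monoˡ-≤; +-mono-<;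
         +-identityʳ; +-identityˡ; +-assoc; *-distribˡ-+; *-monoʳ-≤-nonNeg; module ≤-Reasoning)
open import Data.Rational.Solver using (module +-*-Solver)
open import Data.List using (List; []; _∷_; foldr)
open import Data.List.Relation.Unary.All using (All; []; _∷_)
open import Data.List.Relation.Unary.Linked using ([]; [-]; _∷_)
open import Data.Product using (_×_; Σ-syntax; _,_; proj₁; proj₂)
open import Data.Fin using (Fin)
open import Data.Fin.Properties using (all?)
open import Relation.Nullary using (Dec; yes; no)
open import Relation.Binary.PropositionalEquality
  using (_≡_; _≗_; refl; sym; trans; cong; subst; module ≡-Reasoning)

p≤p+q : ∀ {p q} → 0ℚ ≤ q → p ≤ p + q
p≤p+q {p} {q} 0≤q = begin
  p       ≡⟨ sym (+-identityʳ p) ⟩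
  p + 0ℚ  ≤⟨ +-monoʳ-≤ p 0≤q ⟩
  p + q   ∎
  where open ≤-Reasoning

q≤p+q : ∀ {p q} → 0ℚ ≤ p → q ≤ p + q
q≤p+q {p} {q} 0≤p = begin
  q       ≡⟨ sym (+-identityˡ q) ⟩
  0ℚ + q  ≤⟨ +-monoˡ-≤ q 0≤p ⟩
  p + q   ∎
  where open ≤-Reasoning

*-+-split : ∀ v s t a → v + (s + t) * a ≡ (v + s * a) + t * a
*-+-split = solve 4 (λ v s t a → v :+ (s :+ t) :* a := (v :+ s :* a) :+ t :* a) refl
  where open +-*-Solver

merged-cost≤ : ∀ {d d₁ d₂ c c₁ c₂ s t} → 0ℚ ≤ s → 0ℚ ≤ t →
  d ≤ d₁ + d₂ → c ≤ c₁ → c ≤ c₂ →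
  d + c * (s + t) ≤ (d₁ + c₁ * s) + (d₂ + c₂ * t)
merged-cost≤ {d} {d₁} {d₂} {c} {c₁} {c₂} {s} {t} 0≤s 0≤t d≤ c≤c₁ c≤c₂ = begin
  d + c * (s + t)
    ≡⟨ cong (d +_) (*-distribˡ-+ c s t) ⟩
  d + (c * s + c * t)
    ≤⟨ +-mono-≤ d≤ (+-mono-≤ (scale 0≤s c≤c₁) (scale 0≤t c≤c₂)) ⟩
  (d₁ + d₂) + (c₁ * s + c₂ * t)
    ≡⟨ regroup d₁ d₂ (c₁ * s) (c₂ * t) ⟩
  (d₁ + c₁ * s) + (d₂ + c₂ * t) ∎
  where
  open ≤-Reasoning
  scale : ∀ {r p q} → 0ℚ ≤ r → p ≤ q → p * r ≤ q * r
  scale {r} 0≤r = *-monoʳ-≤-nonNeg r {{nonNegative 0≤r}}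
  regroup : ∀ a b x y → (a + b) + (x + y) ≡ (a + x) + (b + y)
  regroup = solve 4 (λ a b x y → (a :+ b) :+ (x :+ y) := (a :+ x) :+ (b :+ y)) refl
    where open +-*-Solver

module _ (𝒜 : MMS) where
  open MMS 𝒜

  State : Set
  State = Fin dim → ℚ

  after : State → TimedAction 𝒜 → State
  after V a j = V j + proj₂ a * A (proj₁ a) j

  after-cong : ∀ {V W} a → W ≗ V → after W a ≗ after V a
  after-cong a W≗V j = cong (_+ proj₂ a * A (proj₁ a) j) (W≗V j)

  PositiveDurations : List (TimedAction 𝒜) → Set
  PositiveDurations = All (λ a → 0ℚ < proj₂ a)

  sameSlope? : ∀ m m' → Dec (SameSlope 𝒜 m m')
  sameSlope? m m' = all? (λ j → A m j ≟ A m' j)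

  cheaper : Fin nModes → Fin nModes → Fin nModes
  cheaper m m' with πc m ≤? πc m'
  ... | yes _ = m
  ... | no  _ = m'

  cheaper-πc≤ˡ : ∀ m m' → πc (cheaper m m') ≤ πc m
  cheaper-πc≤ˡ m m' with πc m ≤? πc m'
  ... | yes _    = ≤-refl
  ... | no  m≰m' = <⇒≤ (≰⇒> m≰m')

  cheaper-πc≤ʳ : ∀ m m' → πc (cheaper m m') ≤ πc m'
  cheaper-πc≤ʳ m m' with πc m ≤? πc m'
  ... | yes m≤m' = m≤m'
  ... | no  _    = ≤-refl

  cheaper-πd≤ : ∀ m m' → πd (cheaper m m') ≤ πd m + πd m'
  cheaper-πd≤ m m' with πc m ≤? πc m'
  ... | yes _ = p≤p+q (πd≥0 m')
  ... | no  _ = q≤p+q (πd≥0 m)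

  cheaper-sameSlope : ∀ {m m'} → SameSlope 𝒜 m m' → SameSlope 𝒜 (cheaper m m') m'
  cheaper-sameSlope {m} {m'} m~m' with πc m ≤? πc m'
  ... | yes _ = m~m'
  ... | no  _ = λ _ → refl

  merge : TimedAction 𝒜 → TimedAction 𝒜 → TimedAction 𝒜
  merge (m , s) (m' , t) = cheaper m m' , s + t

  after-merge : ∀ V a b → SameSlope 𝒜 (proj₁ a) (proj₁ b) →
    after V (merge a b) ≗ after (after V a) b
  after-merge V (m , s) (m' , t) m~m' j = begin
    V j + (s + t) * A (cheaper m m') j
      ≡⟨ cong (λ x → V j + (s + t) * x) (cheaper-sameSlope m~m' j) ⟩
    V j + (s + t) * A m' j
      ≡⟨ *-+-split (V j) s t (A m' j) ⟩
    (V j + s * A m' j) + t * A m' j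
      ≡⟨ cong (λ x → (V j + s * x) + t * A m' j) (sym (m~m' j)) ⟩
    (V j + s * A m j) + t * A m' j      ∎
    where open ≡-Reasoning

  cost-merge≤ : ∀ a b τ → 0ℚ ≤ proj₂ a → 0ℚ ≤ proj₂ b →
    cost 𝒜 (merge a b ∷ τ) ≤ cost 𝒜 (a ∷ b ∷ τ)
  cost-merge≤ (m , s) (m' , t) τ 0≤s 0≤t = begin
    (πd (cheaper m m') + πc (cheaper m m') * (s + t)) + C
      ≤⟨ +-monoˡ-≤ C (merged-cost≤ {d₁ = πd m} {d₂ = πd m'} 0≤s 0≤t
                       (cheaper-πd≤ m m') (cheaper-πc≤ˡ m m') (cheaper-πc≤ʳ m m')) ⟩
    ((πd m + πc m * s) + (πd m' + πc m' * t)) + C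
      ≡⟨ +-assoc (πd m + πc m * s) (πd m' + πc m' * t) C ⟩
    (πd m + πc m * s) + ((πd m' + πc m' * t) + C) ∎
    where
    open ≤-Reasoning
    C : ℚ
    C = cost 𝒜 τ

  angular-replaceHead : ∀ {a b} τ → SameSlope 𝒜 (proj₁ a) (proj₁ b) →
    Angular 𝒜 (b ∷ τ) → Angular 𝒜 (a ∷ τ)
  angular-replaceHead []      _    _            = [-]
  angular-replaceHead (_ ∷ _) a~b (b≁c ∷ rest) =
    (λ a~c → b≁c (λ j → trans (sym (a~b j)) (a~c j))) ∷ rest

  mergeCons : TimedAction 𝒜 → List (TimedAction 𝒜) → List (TimedAction 𝒜)
  mergeCons a []      = a ∷ []
  mergeCons a (b ∷ τ) with sameSlope? (proj₁ a) (proj₁ b)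
  ... | yes _ = merge a b ∷ τ
  ... | no  _ = a ∷ b ∷ τ

  mergeCons-positive : ∀ {a} τ →
    PositiveDurations (a ∷ τ) → PositiveDurations (mergeCons a τ)
  mergeCons-positive []      ps = ps
  mergeCons-positive {a} (b ∷ τ) ps with sameSlope? (proj₁ a) (proj₁ b)
  mergeCons-positive {a} (b ∷ τ) (0<s ∷ 0<t ∷ ps) | yes _ = +-mono-< 0<s 0<t ∷ ps
  mergeCons-positive {a} (b ∷ τ) ps                | no  _ = ps

  mergeCons-duration : ∀ a τ → duration 𝒜 (mergeCons a τ) ≡ duration 𝒜 (a ∷ τ)
  mergeCons-duration a [] = refl
  mergeCons-duration a (b ∷ τ) with sameSlope? (proj₁ a) (proj₁ b)
  ... | yes _ = +-assoc (proj₂ a) (proj₂ b) (duration 𝒜 τ)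
  ... | no  _ = refl

  mergeCons-angular : ∀ a τ → Angular 𝒜 τ → Angular 𝒜 (mergeCons a τ)
  mergeCons-angular a [] _ = [-]
  mergeCons-angular a (b ∷ τ) ang with sameSlope? (proj₁ a) (proj₁ b)
  ... | yes a~b = angular-replaceHead τ (cheaper-sameSlope a~b) ang
  ... | no  a≁b = a≁b ∷ ang

  mergeCons-cost≤ : ∀ a τ → PositiveDurations (a ∷ τ) →
    cost 𝒜 (mergeCons a τ) ≤ cost 𝒜 (a ∷ τ)
  mergeCons-cost≤ a [] _ = ≤-refl
  mergeCons-cost≤ a (b ∷ τ) ps with sameSlope? (proj₁ a) (proj₁ b)
  mergeCons-cost≤ a (b ∷ τ) (0<s ∷ 0<t ∷ _) | yes _ = cost-merge≤ a b τ (<⇒≤ 0<s) (<⇒≤ 0<t)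
  mergeCons-cost≤ a (b ∷ τ) _               | no  _ = ≤-refl

  angularise : List (TimedAction 𝒜) → List (TimedAction 𝒜)
  angularise = foldr mergeCons []

  angularise-positive : ∀ σ → PositiveDurations σ → PositiveDurations (angularise σ)
  angularise-positive []      []       = []
  angularise-positive (a ∷ σ) (p ∷ ps) =
    mergeCons-positive (angularise σ) (p ∷ angularise-positive σ ps)

  angularise-duration : ∀ σ → duration 𝒜 (angularise σ) ≡ duration 𝒜 σ
  angularise-duration []      = refl
  angularise-duration (a ∷ σ) =
    trans (mergeCons-duration a (angularise σ)) (cong (proj₂ a +_) (angularise-duration σ))

  angularise-angular : ∀ σ → Angular 𝒜 (angularise σ)
  angularise-angular []      = []
  angularise-angular (a ∷ σ) = mergeCons-angular a (angularise σ) (angularise-angular σ)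

  angularise-cost≤ : ∀ σ → PositiveDurations σ → cost 𝒜 (angularise σ) ≤ cost 𝒜 σ
  angularise-cost≤ []      []       = ≤-refl
  angularise-cost≤ (a ∷ σ) (p ∷ ps) = begin
    cost 𝒜 (mergeCons a (angularise σ))
      ≤⟨ mergeCons-cost≤ a (angularise σ) (p ∷ angularise-positive σ ps) ⟩
    cost 𝒜 (a ∷ angularise σ)
      ≤⟨ +-monoʳ-≤ (πd (proj₁ a) + πc (proj₁ a) * proj₂ a) (angularise-cost≤ σ ps) ⟩
    cost 𝒜 (a ∷ σ)                       ∎
    where open ≤-Reasoning

  angularise-schedule : ∀ {tmax} σ → IsSchedule 𝒜 tmax σ → IsSchedule 𝒜 tmax (angularise σ)
  angularise-schedule σ (ps , dur) = angularise-positive σ ps , trans (angularise-duration σ) dur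

  module _ (Q : Fin dim → ℚ → Set) where

    Within : State → Set
    Within V = ∀ j → Q j (V j)

    within-resp : ∀ {V W} → W ≗ V → Within V → Within W
    within-resp W≗V v j = subst (Q j) (sym (W≗V j)) (v j)

    runFrom-within-resp : ∀ {V W} σ → W ≗ V →
      All Within (runFrom 𝒜 V σ) → All Within (runFrom 𝒜 W σ)
    runFrom-within-resp []      _   []       = []
    runFrom-within-resp (a ∷ σ) W≗V (v ∷ vs) =
      within-resp (after-cong a W≗V) v ∷ runFrom-within-resp σ (after-cong a W≗V) vs

    mergeCons-within : ∀ V a τ →
      All Within (runFrom 𝒜 V (a ∷ τ)) → All Within (runFrom 𝒜 V (mergeCons a τ))
    mergeCons-within V a [] vs = vs
    mergeCons-within V a (b ∷ τ) vs with sameSlope? (proj₁ a) (proj₁ b)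
    mergeCons-within V a (b ∷ τ) (_ ∷ v ∷ vs) | yes a~b =
      within-resp (after-merge V a b a~b) v ∷ runFrom-within-resp τ (after-merge V a b a~b) vs
    mergeCons-within V a (b ∷ τ) vs           | no  _   = vs

    angularise-within : ∀ V σ →
      All Within (runFrom 𝒜 V σ) → All Within (runFrom 𝒜 V (angularise σ))
    angularise-within V []      []       = []
    angularise-within V (a ∷ σ) (v ∷ vs) =
      mergeCons-within V a (angularise σ) (v ∷ angularise-within (after V a) σ vs)

    angularise-improves : ∀ {tmax} σ → IsSchedule 𝒜 tmax σ → All Within (run 𝒜 σ) →
      Σ[ σ' ∈ List (TimedAction 𝒜) ]
        (IsSchedule 𝒜 tmax σ' × Angular 𝒜 σ' × All Within (run 𝒜 σ') ×
         cost 𝒜 σ' ≤ cost 𝒜 σ)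
    angularise-improves σ sched@(ps , _) vs =
      angularise σ , angularise-schedule σ sched , angularise-angular σ ,
      angularise-within V0 σ vs , angularise-cost≤ σ ps

proposition2 : (𝒜 : MMS) (tmax ε : ℚ) → 0ℚ < tmax → 0ℚ ≤ ε →
    (σ : List (TimedAction 𝒜)) → IsSchedule 𝒜 tmax σ →
    ((Safe 𝒜 σ →
      Σ[ σ' ∈ List (TimedAction 𝒜) ]
        (IsSchedule 𝒜 tmax σ' × Angular 𝒜 σ' × Safe 𝒜 σ' × cost 𝒜 σ' ≤ cost 𝒜 σ))
    × (EpsSafe 𝒜 ε σ →
      Σ[ σ' ∈ List (TimedAction 𝒜) ]
        (IsSchedule 𝒜 tmax σ' × Angular 𝒜 σ' × EpsSafe 𝒜 ε σ' × cost 𝒜 σ' ≤ cost 𝒜 σ)))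
proposition2 𝒜 tmax ε _ _ σ sched =
  angularise-improves 𝒜 (λ j x → (Vmin j ≤ x) × (x ≤ Vmax j)) σ sched ,
  angularise-improves 𝒜 (λ j x → (Vmin j - ε < x) × (x < Vmax j + ε)) σ sched
  where open MMS 𝒜
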